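{- Let $\mathtt{Compress}:\Sigma^*\to(\Sigma')^*$ be the (non-overlapping) LZ77 compression function with unbounded sliding window size $W=n$, as described in the context. Then, for strings of length $n$, $$\mathrm{GS}_{\mathtt{Compress}}\le\Big(\tfrac{\sqrt[3]{9}}{2}n^{2/3}+\tfrac{\sqrt[3]{3}}{2}n^{1/3}+1\Big)\big(2\lceil\log n\rceil+\lceil\log|\Sigma|\rceil\big)=O(n^{2/3}\log n).$$
   Context: All logarithms are base 2. For $w\in\Sigma^n$, $w[i]$ is its $i$-th character and $w[a,b]$ the substring from position $a$ to $b$. Non-overlapping LZ77 with window $W\le n$: the output on $w\in\Sigma^n$ is a sequence of blocks $B_1,\dots,B_t$, $B_i=[q_i,\ell_i,c_i]$ with integers $0\le q_i,\ell_i<n$ and $c_i\in\Sigma$; set $s_i=1+\sum_{r<i}(\ell_r+1)$ and $f_i=s_i+\ell_i$, so $B_i$ encodes $w[s_i,f_i]$. Greedily, $B_1=[0,0,w[1]]$; if the first $\mathsf{ctc}<n$ characters have been encoded, the next block uses the largest $\ell\ge 0$ (with $\mathsf{ctc}+\ell<n$) such that $w[\mathsf{ctc}+1,\mathsf{ctc}+\ell]=w[z-\ell+1,z]$ for some $z$ with $\max\{0,\mathsf{ctc}-W\}+\ell\le z\le\mathsf{ctc}$; if $\ell=0$ the block is $[0,0,w[\mathsf{ctc}+1]]$, otherwise it is $[z-\ell+1,\ell,w[\mathsf{ctc}+\ell+1]]$; then $\mathsf{ctc}$ increases by $\ell+1$, and the algorithm stops when $\mathsf{ctc}=n$. Each block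 is encoded with $2\lceil\log n\rceil+\lceil\log|\Sigma|\rceil$ bits, so $|\mathtt{Compress}(w)|=t(2\lceil\log n\rceil+\lceil\log|\Sigma|\rceil)$. Strings $w,w'\in\Sigma^n$ are neighbors ($w\sim w'$) if they differ in exactly one position, and $\mathrm{GS}_{\mathtt{Compress}}=\max_{w\in\Sigma^n}\max_{w'\sim w}\big||\mathtt{Compress}(w)|-|\mathtt{Compress}(w')|\big|$. -}

module Defs where

open import Data.Nat using (ℕ; zero; suc; _+_; _*_; _∸_; _<?_; _≤?_)
open import Data.Bool using (Bool; true; false; _∧_; _∨_; if_then_else_)
open import Data.Fin using (Fin; fromℕ<) renaming (_≟_ to _≟F_)
open import Data.Vec using (Vec; lookup)
open import Data.List using (List; []; _∷_; length)
open import Data.Product using (_×_; _,_; Σ; ∃; proj₁; proj₂)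
open import Data.Maybe using (Maybe; just; nothing)
open import Relation.Nullary using (¬_; yes; no; does)
open import Relation.Binary.PropositionalEquality using (_≡_)
open import Data.Nat.Logarithm using (⌈log₂_⌉)

-- Alphabet Σ = Fin k (so |Σ| = k).  Strings of length n: Vec (Fin k) n.
-- Internally positions are 0-indexed: w[i] (1-indexed) = lookup w (i-1).

at : ∀ {k n} → Vec (Fin k) n → ℕ → Maybe (Fin k)
at {n = n} w i with i <? n
... | yes p = just (lookup w (fromℕ< p))
... | no _  = nothing

eqM : ∀ {k} → Maybe (Fin k) → Maybe (Fin k) → Bool
eqM (just a) (just b) = does (a ≟F b)
eqM _ _ = false

-- w[c+1 .. c+l] = w[p+1 .. p+l]  (1-indexed), i.e. 0-indexed positions c..c+l-1 vs p..p+l-1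
matchesFrom : ∀ {k n} → Vec (Fin k) n → ℕ → ℕ → ℕ → Bool
matchesFrom w p c zero = true
matchesFrom w p c (suc l) = eqM (at w (c + l)) (at w (p + l)) ∧ matchesFrom w p c l

-- Search for a source start p (0-indexed; p = z - l where z is the paper's end position)
-- among p ∈ [lo, lo + cnt), returning the smallest one that matches.
findSrc : ∀ {k n} → Vec (Fin k) n → ℕ → ℕ → ℕ → ℕ → Maybe ℕ
findSrc w c l lo zero = nothing
findSrc w c l lo (suc cnt) =
  if matchesFrom w lo c l then just lo else findSrc w c l (suc lo) cnt

-- Admissible sources for length l at ctc with window W:
-- max{0, ctc-W} + l ≤ z ≤ ctc, p = z - l, i.e. ctc ∸ W ≤ p ≤ ctc ∸ l (and l ≤ ctc).
source : ∀ {k n} → ℕ → Vec (Fin k) n → ℕ → ℕ → Maybe ℕ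
source W w ctc l with l ≤? ctc
... | no _ = nothing
... | yes _ = findSrc w ctc l (ctc ∸ W) (suc (ctc ∸ l) ∸ (ctc ∸ W))

bestFrom : ∀ {k n} → ℕ → Vec (Fin k) n → ℕ → ℕ → ℕ × ℕ
bestFrom W w ctc zero with source W w ctc zero
... | just p  = (zero , p)
... | nothing = (zero , zero)
bestFrom W w ctc (suc m) with source W w ctc (suc m)
... | just p  = (suc m , p)
... | nothing = bestFrom W w ctc m

Block : ℕ → Set
Block k = ℕ × ℕ × Fin k

-- Greedy loop; ctc = number of characters already encoded; fuel bounds the number of
-- blocks (each block encodes ≥ 1 character, so fuel n suffices).
lzGo : ∀ {k n} → ℕ → Vec (Fin k) n → ℕ → ℕ → List (Block k)
lzGo W w zero ctc = []
lzGo {n = n} W w (suc fuel) ctc with ctc <? n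
... | no _ = []
... | yes _ with bestFrom W w ctc (n ∸ ctc ∸ 1)
...   | (l , p) with ctc + l <? n
...     | no _ = []
...     | yes q with l
...       | zero  = (0 , 0 , lookup w (fromℕ< q)) ∷ lzGo W w fuel (ctc + 1)
...       | suc l' = (suc p , suc l' , lookup w (fromℕ< q)) ∷ lzGo W w fuel (ctc + suc l' + 1)

LZ77 : ∀ {k n} → ℕ → Vec (Fin k) n → List (Block k)
LZ77 {n = n} W w = lzGo W w n 0

blockBits : ℕ → ℕ → ℕ
blockBits k n = 2 * ⌈log₂ n ⌉ + ⌈log₂ k ⌉

compressSize : ∀ {k n} → Vec (Fin k) n → ℕ
compressSize {k} {n} w = length (LZ77 n w) * blockBits k n

Neighbors : ∀ {k n} → Vec (Fin k) n → Vec (Fin k) n → Set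
Neighbors {n = n} w w' =
  Σ (Fin n) λ i → ¬ (lookup w i ≡ lookup w' i) ×
    ((j : Fin n) → ¬ (j ≡ i) → lookup w j ≡ lookup w' j)

module Submission where

-- Compare the greedy parses of w and w′ phrase by phrase, where w′ differs from w at position i.
-- Greedy parsing is monotone and optimal phrase by phrase, so a phrase of w that is still copyable
-- in w′ costs w′ at most one block, and a phrase whose target or source contains i costs at most
-- two (the copyable pieces on either side of i).  The target contains i for one phrase only.  A
-- source containing i is charged only the first time its interval occurs: later occurrences copy
-- from that first occurrence, which lies beyond i.  The charged intervals are distinct, cover i and
-- have total length at most n; as only l of them can have length l, for m = ⌊∛(3n)⌋ there are at
-- most m(m+1)/2 of them, and m ≤ ∛(3n), m² ≤ ∛(9n²).

open import Defs

module Parsing where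

  open import Data.Nat
  open import Data.Nat.Properties
  open import Data.Nat.ListAction using (sum)
  open import Data.Nat.ListAction.Properties using (sum-++; sum-↭)
  open import Data.Nat.Tactic.RingSolver using (solve-∀)
  open import Data.Bool using (true; false)
  open import Data.Bool.Properties using (∧-conicalˡ; ∧-conicalʳ)
  open import Data.Fin using (Fin; toℕ; fromℕ<) renaming (_≟_ to _≟F_)
  open import Data.Fin.Properties using (toℕ-fromℕ<)
  open import Data.Vec using (Vec; lookup)
  open import Data.Maybe using (Maybe; just; nothing)
  open import Data.Product using (_×_; _,_; proj₁; proj₂; ∃-syntax)
  open import Data.Product.Properties using (≡-dec)
  open import Data.Sum using (_⊎_; inj₁; inj₂)
  open import Data.List using (List; []; _∷_; _++_; map; length)
  open import Data.List.Properties using (map-++)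
  open import Data.List.Relation.Unary.All as All using (All; []; _∷_)
  open import Data.List.Relation.Unary.All.Properties using (¬Any⇒All¬)
  open import Data.List.Relation.Unary.Any using (here; there)
  open import Data.List.Relation.Unary.Unique.Propositional using (Unique; []; _∷_)
  open import Data.List.Membership.Propositional using (_∈_; _∉_)
  open import Data.List.Membership.Propositional.Properties using (∈-∃++; ∈-++⁺ˡ; ∈-++⁺ʳ)
  open import Data.List.Membership.DecPropositional (≡-dec _≟_ _≟_) using (_∈?_)
  open import Data.List.Relation.Binary.Permutation.Propositional.Properties
    using (shift; ∈-resp-↭) renaming (map⁺ to ↭-map⁺)
  open import Function using (_∘_; _∘′_)
  open import Relation.Nullary using (¬_; yes; no; contradiction)
  open import Relation.Nullary.Decidable using (_×-dec_)
  open import Relation.Binary.PropositionalEquality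

  m+n+1≡m+[1+n] : ∀ m n → m + n + 1 ≡ m + suc n
  m+n+1≡m+[1+n] m n = trans (+-assoc m n 1) (cong (m +_) (+-comm n 1))

  module _ {k n : ℕ} (v : Vec (Fin k) n) where

    Agree : ℕ → ℕ → Set
    Agree x y = eqM (at v x) (at v y) ≡ true

    Match : ℕ → ℕ → ℕ → Set
    Match p x l = ∀ {r} → r < l → Agree (x + r) (p + r)

    Copyable : ℕ → ℕ → Set
    Copyable x l = ∃[ p ] p + l ≤ x × Match p x l

  eqM-just : ∀ {k} (a b : Maybe (Fin k)) → eqM a b ≡ true → ∃[ x ] a ≡ just x × b ≡ just x
  eqM-just (just x) (just y) e with x ≟F y | e
  ... | yes refl | _ = x , refl , refl
  ... | no _     | ()

  eqM-refl : ∀ {k} (x : Fin k) → eqM (just x) (just x) ≡ true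
  eqM-refl x with x ≟F x
  ... | yes _ = refl
  ... | no x≢x = contradiction refl x≢x

  module MatchProperties {k n : ℕ} (v : Vec (Fin k) n) where

    Agree-sym : ∀ {x y} → Agree v x y → Agree v y x
    Agree-sym {x} {y} h with eqM-just (at v x) (at v y) h
    ... | a , ex , ey rewrite ex | ey = eqM-refl a

    Agree-trans : ∀ {x y z} → Agree v x y → Agree v y z → Agree v x z
    Agree-trans {x} {y} {z} h₁ h₂
      with eqM-just (at v x) (at v y) h₁ | eqM-just (at v y) (at v z) h₂
    ... | a , ex , ey | b , ey′ , ez rewrite ex | ez with trans (sym ey) ey′
    ... | refl = eqM-refl a

    matchesFrom-sound : ∀ {p x} l → matchesFrom v p x l ≡ true → Match v p x l
    matchesFrom-sound {p} {x} (suc l) h {r} r<1+l with m≤n⇒m<n∨m≡n (s≤s⁻¹ r<1+l)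
    ... | inj₁ r<l  = matchesFrom-sound l (∧-conicalʳ _ (matchesFrom v p x l) h) r<l
    ... | inj₂ refl = ∧-conicalˡ _ (matchesFrom v p x l) h

    matchesFrom-complete : ∀ {p x} l → Match v p x l → matchesFrom v p x l ≡ true
    matchesFrom-complete zero    m = refl
    matchesFrom-complete (suc l) m rewrite m (n<1+n l) =
      matchesFrom-complete l (λ r<l → m (m<n⇒m<1+n r<l))

    Match-suffix : ∀ {p x l} a → a ≤ l → Match v p x l → Match v (p + a) (x + a) (l ∸ a)
    Match-suffix {p} {x} {l} a a≤l h {r} r<l∸a =
      subst₂ (Agree v) (sym (+-assoc x a r)) (sym (+-assoc p a r))
        (h (subst (a + r <_) (m+[n∸m]≡n a≤l) (+-monoʳ-< a r<l∸a)))

    Copyable-suffix : ∀ {x l} a → a ≤ l → Copyable v x l → Copyable v (x + a) (l ∸ a)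
    Copyable-suffix {x} {l} a a≤l (p , p+l≤x , h) =
      p + a , ≤-trans (≤-reflexive p+a+[l∸a]≡p+l) (≤-trans p+l≤x (m≤m+n x a)) , Match-suffix a a≤l h
      where
      p+a+[l∸a]≡p+l : p + a + (l ∸ a) ≡ p + l
      p+a+[l∸a]≡p+l = trans (+-assoc p a (l ∸ a)) (cong (p +_) (m+[n∸m]≡n a≤l))

  module Greedy {k n : ℕ} (v : Vec (Fin k) n) where

    open MatchProperties v

    findSrc-just : ∀ {c l lo cnt p} → findSrc v c l lo cnt ≡ just p →
                   lo ≤ p × p < lo + cnt × Match v p c l
    findSrc-just {c} {l} {lo} {suc cnt} {p} e with matchesFrom v lo c l in match
    findSrc-just {c} {l} {lo} refl | true = ≤-refl , m<m+n lo z<s , matchesFrom-sound l match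
    ... | false with findSrc-just e
    ... | lo<p , p<lo+1+cnt , h = <⇒≤ lo<p , subst (p <_) (sym (+-suc lo cnt)) p<lo+1+cnt , h

    findSrc-nothing : ∀ {c l lo cnt p} → findSrc v c l lo cnt ≡ nothing →
                      lo ≤ p → p < lo + cnt → ¬ Match v p c l
    findSrc-nothing {lo = lo} {zero} {p} _ lo≤p p<lo+0 =
      contradiction (subst (p <_) (+-identityʳ lo) p<lo+0) (≤⇒≯ lo≤p)
    findSrc-nothing {c} {l} {lo} {suc cnt} {p} e lo≤p p<lo+1+cnt h with matchesFrom v lo c l in match
    findSrc-nothing () _ _ _ | true
    ... | false with m≤n⇒m<n∨m≡n lo≤p
    ... | inj₂ refl = contradiction (trans (sym (matchesFrom-complete l h)) match) λ ()
    ... | inj₁ lo<p = findSrc-nothing e lo<p (subst (p <_) (+-suc lo cnt) p<lo+1+cnt) h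

    -- For c ≤ n the window reaches back to position 0, and the candidate sources are p ≤ c ∸ l.
    source-just : ∀ {c l p} → c ≤ n → source n v c l ≡ just p → p + l ≤ c × Match v p c l
    source-just {c} {l} c≤n e with l ≤? c
    ... | yes l≤c rewrite m≤n⇒m∸n≡0 c≤n with findSrc-just e
    ...   | _ , p<1+c∸l , h = subst (_ + l ≤_) (m∸n+n≡m l≤c) (+-monoˡ-≤ l (s≤s⁻¹ p<1+c∸l)) , h

    source-nothing : ∀ {c l} → c ≤ n → source n v c l ≡ nothing → ¬ Copyable v c l
    source-nothing {c} {l} c≤n e (p , p+l≤c , h) with l ≤? c
    ... | no l≰c = l≰c (≤-trans (m≤n+m l p) p+l≤c)
    ... | yes l≤c rewrite m≤n⇒m∸n≡0 c≤n =
      findSrc-nothing e z≤n (s≤s (m+n≤o⇒m≤o∸n p p+l≤c)) h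

    bestFrom-≤ : ∀ c m → proj₁ (bestFrom n v c m) ≤ m
    bestFrom-≤ c zero with source n v c zero
    ... | just _  = z≤n
    ... | nothing = z≤n
    bestFrom-≤ c (suc m) with source n v c (suc m)
    ... | just _  = ≤-refl
    ... | nothing = m≤n⇒m≤1+n (bestFrom-≤ c m)

    bestFrom-source : ∀ {c} m → c ≤ n → let l , p = bestFrom n v c m in p + l ≤ c × Match v p c l
    bestFrom-source {c} zero c≤n with source n v c zero in e
    ... | just _  = source-just c≤n e
    ... | nothing = z≤n , λ ()
    bestFrom-source {c} (suc m) c≤n with source n v c (suc m) in e
    ... | just _  = source-just c≤n e
    ... | nothing = bestFrom-source m c≤n

    bestFrom-maximal : ∀ {c l} m → c ≤ n → l ≤ m → Copyable v c l → l ≤ proj₁ (bestFrom n v c m)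
    bestFrom-maximal {c} zero c≤n z≤n _ = z≤n
    bestFrom-maximal {c} {l} (suc m) c≤n l≤1+m h with source n v c (suc m) in e
    ... | just _  = l≤1+m
    ... | nothing with m≤n⇒m<n∨m≡n l≤1+m
    ...   | inj₁ l<1+m = bestFrom-maximal m c≤n (s≤s⁻¹ l<1+m) h
    ...   | inj₂ refl  = contradiction h (source-nothing c≤n e)

    len : ℕ → ℕ
    len x = proj₁ (bestFrom n v x (n ∸ x ∸ 1))

    src : ℕ → ℕ
    src x = proj₂ (bestFrom n v x (n ∸ x ∸ 1))

    next : ℕ → ℕ
    next x = x + len x + 1

    x<next : ∀ x → x < next x
    x<next x = subst (x <_) (+-comm 1 (x + len x)) (s≤s (m≤m+n x (len x)))

    1+x+[n∸x∸1]≡n : ∀ {x} → x < n → suc x + (n ∸ x ∸ 1) ≡ n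
    1+x+[n∸x∸1]≡n {x} x<n =
      trans (cong (suc x +_) (trans (∸-+-assoc n x 1) (cong (n ∸_) (+-comm x 1)))) (m+[n∸m]≡n x<n)

    len-fits : ∀ {x} → x < n → x + len x < n
    len-fits {x} x<n = subst (suc (x + len x) ≤_) (1+x+[n∸x∸1]≡n x<n)
                             (s≤s (+-monoʳ-≤ x (bestFrom-≤ x (n ∸ x ∸ 1))))

    src-matches : ∀ {x} → x < n → src x + len x ≤ x × Match v (src x) x (len x)
    src-matches {x} x<n = bestFrom-source (n ∸ x ∸ 1) (<⇒≤ x<n)

    len-copyable : ∀ {x} → x < n → Copyable v x (len x)
    len-copyable x<n = _ , src-matches x<n

    len-maximal : ∀ {x l} → x + l < n → Copyable v x l → l ≤ len x
    len-maximal {x} {l} x+l<n h = bestFrom-maximal (n ∸ x ∸ 1) x≤n l≤n∸x∸1 h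
      where
      x≤n : x ≤ n
      x≤n = ≤-trans (m≤m+n x l) (<⇒≤ x+l<n)
      x<n : x < n
      x<n = ≤-<-trans (m≤m+n x l) x+l<n
      l≤n∸x∸1 : l ≤ n ∸ x ∸ 1
      l≤n∸x∸1 = +-cancelˡ-≤ (suc x) l _ (subst (suc x + l ≤_) (sym (1+x+[n∸x∸1]≡n x<n)) x+l<n)

    next≤n : ∀ {x} → x < n → next x ≤ n
    next≤n {x} x<n = subst (_≤ n) (+-comm 1 (x + len x)) (len-fits x<n)

    fuel-next : ∀ x {f} → n ∸ x ≤ suc f → n ∸ next x ≤ f
    fuel-next x {f} fuel = ≤-trans (∸-monoʳ-≤ n (x<next x))
                                     (subst (_≤ f) (pred[m∸n]≡m∸[1+n] n x) (pred-mono-≤ fuel))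

    next-mono : ∀ {x y} → x ≤ y → y < n → next x ≤ next y
    next-mono {x} {y} x≤y y<n with y ≤? x + len x
    ... | no y≰x+len = ≤-trans (subst (_≤ y) (+-comm 1 (x + len x)) (≰⇒> y≰x+len))
                               (<⇒≤ (x<next y))
    ... | yes y≤x+len = +-monoˡ-≤ 1 (subst (_≤ y + len y) (sym x+len≡y+rest)
                                       (+-monoʳ-≤ y (len-maximal fits copyable)))
      where
      a = y ∸ x
      x+a≡y : x + a ≡ y
      x+a≡y = m+[n∸m]≡n x≤y
      a≤len : a ≤ len x
      a≤len = +-cancelˡ-≤ x a (len x) (subst (_≤ x + len x) (sym x+a≡y) y≤x+len)
      x+len≡y+rest : x + len x ≡ y + (len x ∸ a)
      x+len≡y+rest = trans (cong (x +_) (sym (m+[n∸m]≡n a≤len)))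
                           (trans (sym (+-assoc x a _)) (cong (_+ (len x ∸ a)) x+a≡y))
      fits : y + (len x ∸ a) < n
      fits = subst (_< n) x+len≡y+rest (len-fits (≤-<-trans x≤y y<n))
      copyable : Copyable v y (len x ∸ a)
      copyable = subst (λ z → Copyable v z (len x ∸ a)) x+a≡y
                       (Copyable-suffix a a≤len (len-copyable (≤-<-trans x≤y y<n)))

    blocks : ℕ → ℕ → ℕ
    blocks fuel x = length (lzGo n v fuel x)

    blocks-step : ∀ f {x} → x < n → blocks (suc f) x ≡ suc (blocks f (next x))
    blocks-step f {x} x<n with x <? n
    ... | no x≮n = contradiction x<n x≮n
    ... | yes _ with bestFrom n v x (n ∸ x ∸ 1) | len-fits x<n
    ...   | zero , _ | fits with x + zero <? n
    ...     | no ¬fits = contradiction fits ¬fits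
    ...     | yes _ = cong (λ y → suc (blocks f (y + 1))) (sym (+-identityʳ x))
    blocks-step f {x} x<n | yes _ | suc l , _ | fits with x + suc l <? n
    ...     | no ¬fits = contradiction fits ¬fits
    ...     | yes _ = refl

    blocks-done : ∀ f {x} → n ≤ x → blocks f x ≡ 0
    blocks-done zero    _ = refl
    blocks-done (suc f) {x} n≤x with x <? n
    ... | yes x<n = contradiction x<n (≤⇒≯ n≤x)
    ... | no _    = refl

    blocks-antitone : ∀ f g {x y} → n ∸ x ≤ f → x ≤ y → blocks g y ≤ blocks f x
    blocks-antitone f g {x} {y} fuel x≤y with n ≤? y
    ... | yes n≤y = subst (_≤ blocks f x) (sym (blocks-done g n≤y)) z≤n
    ... | no n≰y with f | g
    ...   | zero   | _      = contradiction (≤-trans (m<n⇒0<n∸m x<n) fuel) λ ()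
      where x<n = ≤-<-trans x≤y (≰⇒> n≰y)
    ...   | suc f′ | zero   = z≤n
    ...   | suc f′ | suc g′
      rewrite blocks-step f′ (≤-<-trans x≤y (≰⇒> n≰y)) | blocks-step g′ (≰⇒> n≰y) =
      s≤s (blocks-antitone f′ g′ (fuel-next x fuel) (next-mono x≤y (≰⇒> n≰y)))

    blocks-copyable : ∀ g {x l} → x + l < n → Copyable v x l → blocks g x ≤ suc (blocks n (x + l + 1))
    blocks-copyable zero    _ _ = z≤n
    blocks-copyable (suc g) {x} {l} x+l<n h rewrite blocks-step g (≤-<-trans (m≤m+n x l) x+l<n) =
      s≤s (blocks-antitone n g (m∸n≤m n (x + l + 1))
            (+-monoˡ-≤ 1 (+-monoʳ-≤ x (len-maximal x+l<n h))))

    blocks-one-mismatch : ∀ {x l p d} → x + l < n → p + l ≤ x → d < l →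
      (∀ {r} → r < l → r ≢ d → Agree v (x + r) (p + r)) → blocks n x ≤ 2 + blocks n (x + l + 1)
    blocks-one-mismatch {x} {l} {p} {d} x+l<n p+l≤x d<l agree = begin
      blocks n x                           ≤⟨ blocks-copyable n (≤-<-trans (+-monoʳ-≤ x (<⇒≤ d<l)) x+l<n) before ⟩
      suc (blocks n (x + d + 1))           ≡⟨ cong (suc ∘ blocks n) (m+n+1≡m+[1+n] x d) ⟩
      suc (blocks n x′)                    ≤⟨ s≤s (blocks-copyable n (subst (_< n) (sym x′+l′≡x+l) x+l<n) after) ⟩
      2 + blocks n (x′ + l′ + 1)           ≡⟨ cong (λ z → 2 + blocks n (z + 1)) x′+l′≡x+l ⟩
      2 + blocks n (x + l + 1)             ∎
      where
      open ≤-Reasoning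
      x′ = x + suc d
      l′ = l ∸ suc d
      x′+l′≡x+l : x′ + l′ ≡ x + l
      x′+l′≡x+l = trans (+-assoc x (suc d) l′) (cong (x +_) (m+[n∸m]≡n d<l))
      before : Copyable v x d
      before = p , ≤-trans (+-monoʳ-≤ p (<⇒≤ d<l)) p+l≤x , λ r<d → agree (<-trans r<d d<l) (<⇒≢ r<d)
      after : Copyable v x′ l′
      after = p + suc d
            , ≤-trans (≤-reflexive (trans (+-assoc p (suc d) l′) (cong (p +_) (m+[n∸m]≡n d<l))))
                      (≤-trans p+l≤x (m≤m+n x (suc d)))
            , λ {r} r<l′ → subst₂ (Agree v) (sym (+-assoc x (suc d) r)) (sym (+-assoc p (suc d) r))
                             (agree (subst (suc d + r <_) (m+[n∸m]≡n d<l) (+-monoʳ-< (suc d) r<l′))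
                                    (λ 1+d+r≡d → <-irrefl (sym 1+d+r≡d) (s≤s (m≤m+n d r))))

  Covers : ℕ → ℕ × ℕ → Set
  Covers i (p , l) = p ≤ i × i < p + l

  cost : List (ℕ × ℕ) → ℕ
  cost []             = 0
  cost ((_ , l) ∷ S) = suc l + cost S

  sum-map-Unique-≤ : ∀ {A : Set} (f : A → ℕ) {S U : List A} → Unique S →
                     (∀ {a} → a ∈ S → f a ≡ 0 ⊎ a ∈ U) → sum (map f S) ≤ sum (map f U)
  sum-map-Unique-≤ f {[]}    _                 _    = z≤n
  sum-map-Unique-≤ f {a ∷ S} {U} (a∉S ∷ unique) weighted with weighted (here refl)
  ... | inj₁ fa≡0 rewrite fa≡0 = sum-map-Unique-≤ f unique (weighted ∘′ there)
  ... | inj₂ a∈U with ∈-∃++ a∈U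
  ...   | ys , zs , refl = begin
    f a + sum (map f S)            ≤⟨ +-monoʳ-≤ (f a) (sum-map-Unique-≤ f unique rest) ⟩
    f a + sum (map f (ys ++ zs))   ≡⟨ sum-↭ (↭-map⁺ f (shift a ys zs)) ⟨
    sum (map f (ys ++ a ∷ zs))     ∎
    where
    open ≤-Reasoning
    rest : ∀ {b} → b ∈ S → f b ≡ 0 ⊎ b ∈ ys ++ zs
    rest {b} b∈S with weighted (there b∈S)
    ... | inj₁ fb≡0 = inj₁ fb≡0
    ... | inj₂ b∈U with ∈-resp-↭ (shift a ys zs) b∈U
    ...   | here b≡a  = contradiction (sym b≡a) (All.lookup a∉S b∈S)
    ...   | there b∈ = inj₂ b∈

  -- The pairs (i ∸ d , l) for d < c; when d > i the truncated subtraction yields junk entries,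
  -- which only make sums over these lists larger.
  intervals : ℕ → ℕ → ℕ → List (ℕ × ℕ)
  intervals i l zero    = []
  intervals i l (suc d) = (i ∸ d , l) ∷ intervals i l d

  shortIntervals : ℕ → ℕ → List (ℕ × ℕ)
  shortIntervals i zero    = []
  shortIntervals i (suc l) = intervals i (suc l) (suc l) ++ shortIntervals i l

  ∈-intervals : ∀ {i l d c} → d < c → (i ∸ d , l) ∈ intervals i l c
  ∈-intervals {c = suc c} d<1+c with m≤n⇒m<n∨m≡n (s≤s⁻¹ d<1+c)
  ... | inj₁ d<c  = there (∈-intervals d<c)
  ... | inj₂ refl = here refl

  ∈-shortIntervals : ∀ {i l d m} → d < l → l ≤ m → (i ∸ d , l) ∈ shortIntervals i m
  ∈-shortIntervals {m = zero} (s≤s _) ()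
  ∈-shortIntervals {i} {l} {d} {suc m} d<l l≤1+m with m≤n⇒m<n∨m≡n l≤1+m
  ... | inj₁ l<1+m = ∈-++⁺ʳ (intervals i (suc m) (suc m)) (∈-shortIntervals d<l (s≤s⁻¹ l<1+m))
  ... | inj₂ refl  = ∈-++⁺ˡ (∈-intervals d<l)

  Covers⇒∈-shortIntervals : ∀ {i m p l} → Covers i (p , l) → l ≤ m → (p , l) ∈ shortIntervals i m
  Covers⇒∈-shortIntervals {i} {m} {p} {l} (p≤i , i<p+l) l≤m =
    subst (λ q → (q , l) ∈ shortIntervals i m) (m∸[m∸n]≡n p≤i) (∈-shortIntervals d<l l≤m)
    where
    d<l : i ∸ p < l
    d<l = +-cancelˡ-< p (i ∸ p) l (subst (_< p + l) (sym (m+[n∸m]≡n p≤i)) i<p+l)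

  shortfall : ℕ → ℕ × ℕ → ℕ
  shortfall m (_ , l) = m ∸ l

  shortfallSum : ℕ → ℕ → ℕ
  shortfallSum m zero    = 0
  shortfallSum m (suc l) = suc l * (m ∸ suc l) + shortfallSum m l

  sum-shortfall-intervals : ∀ m i l c → sum (map (shortfall m) (intervals i l c)) ≡ c * (m ∸ l)
  sum-shortfall-intervals m i l zero    = refl
  sum-shortfall-intervals m i l (suc c) = cong (m ∸ l +_) (sum-shortfall-intervals m i l c)

  sum-shortfall-shortIntervals : ∀ m i k → sum (map (shortfall m) (shortIntervals i k)) ≡ shortfallSum m k
  sum-shortfall-shortIntervals m i zero    = refl
  sum-shortfall-shortIntervals m i (suc k) = begin
    sum (map (shortfall m) (intervals i (suc k) (suc k) ++ shortIntervals i k))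
      ≡⟨ cong sum (map-++ (shortfall m) (intervals i (suc k) (suc k)) (shortIntervals i k)) ⟩
    sum (map (shortfall m) (intervals i (suc k) (suc k)) ++ map (shortfall m) (shortIntervals i k))
      ≡⟨ sum-++ (map (shortfall m) (intervals i (suc k) (suc k))) _ ⟩
    sum (map (shortfall m) (intervals i (suc k) (suc k))) + sum (map (shortfall m) (shortIntervals i k))
      ≡⟨ cong₂ _+_ (sum-shortfall-intervals m i (suc k) (suc k)) (sum-shortfall-shortIntervals m i k) ⟩
    shortfallSum m (suc k) ∎
    where open ≡-Reasoning

  shortfallSum-closed : ∀ {m} k → k ≤ m → 6 * shortfallSum m k + k * suc k * (2 * k + 1) ≡ 3 * m * (k * suc k)
  shortfallSum-closed {m} zero    _     = sym (*-zeroʳ (3 * m))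
  shortfallSum-closed {m} (suc k) 1+k≤m = +-cancelʳ-≡ (k * suc k * (2 * k + 1)) _ _ (begin
    6 * (suc k * e + F) + suc k * suc (suc k) * (2 * suc k + 1) + k * suc k * (2 * k + 1)
      ≡⟨ regroup k e F ⟩
    6 * (suc k * e) + suc k * suc (suc k) * (2 * suc k + 1) + (6 * F + k * suc k * (2 * k + 1))
      ≡⟨ cong (6 * (suc k * e) + suc k * suc (suc k) * (2 * suc k + 1) +_) (shortfallSum-closed k (<⇒≤ 1+k≤m)) ⟩
    6 * (suc k * e) + suc k * suc (suc k) * (2 * suc k + 1) + 3 * m * (k * suc k)
      ≡⟨ cong (λ z → 6 * (suc k * e) + suc k * suc (suc k) * (2 * suc k + 1) + 3 * z * (k * suc k)) m≡e+1+k ⟩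
    6 * (suc k * e) + suc k * suc (suc k) * (2 * suc k + 1) + 3 * (e + suc k) * (k * suc k)
      ≡⟨ telescope k e ⟩
    3 * (e + suc k) * (suc k * suc (suc k)) + k * suc k * (2 * k + 1)
      ≡⟨ cong (λ z → 3 * z * (suc k * suc (suc k)) + k * suc k * (2 * k + 1)) m≡e+1+k ⟨
    3 * m * (suc k * suc (suc k)) + k * suc k * (2 * k + 1) ∎)
    where
    open ≡-Reasoning
    e = m ∸ suc k
    F = shortfallSum m k
    m≡e+1+k : m ≡ e + suc k
    m≡e+1+k = sym (m∸n+n≡m 1+k≤m)
    regroup : ∀ k e F → 6 * (suc k * e + F) + suc k * suc (suc k) * (2 * suc k + 1) + k * suc k * (2 * k + 1)
                      ≡ 6 * (suc k * e) + suc k * suc (suc k) * (2 * suc k + 1) + (6 * F + k * suc k * (2 * k + 1))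
    regroup = solve-∀
    telescope : ∀ k e → 6 * (suc k * e) + suc k * suc (suc k) * (2 * suc k + 1) + 3 * (e + suc k) * (k * suc k)
                      ≡ 3 * (e + suc k) * (suc k * suc (suc k)) + k * suc k * (2 * k + 1)
    telescope = solve-∀

  6*shortfallSum+m≡m³ : ∀ m → 6 * shortfallSum m m + m ≡ m * m * m
  6*shortfallSum+m≡m³ m = +-cancelʳ-≡ (m * suc m * (2 * m + 1)) _ _ (begin
    6 * shortfallSum m m + m + m * suc m * (2 * m + 1)  ≡⟨ swap-last (6 * shortfallSum m m) m _ ⟩
    6 * shortfallSum m m + m * suc m * (2 * m + 1) + m  ≡⟨ cong (_+ m) (shortfallSum-closed m ≤-refl) ⟩
    3 * m * (m * suc m) + m                             ≡⟨ cubes m ⟩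
    m * m * m + m * suc m * (2 * m + 1)                 ∎)
    where
    open ≡-Reasoning
    swap-last : ∀ a b c → a + b + c ≡ a + c + b
    swap-last = solve-∀
    cubes : ∀ m → 3 * m * (m * suc m) + m ≡ m * m * m + m * suc m * (2 * m + 1)
    cubes = solve-∀

  length*≤cost+shortfall : ∀ m S → length S * suc m ≤ cost S + sum (map (shortfall m) S)
  length*≤cost+shortfall m []            = z≤n
  length*≤cost+shortfall m ((p , l) ∷ S) =
    subst (suc m + length S * suc m ≤_) (interchange (suc l) (cost S) (m ∸ l) _)
          (+-mono-≤ (s≤s (m≤n+m∸n m l)) (length*≤cost+shortfall m S))
    where
    interchange : ∀ a b c d → a + c + (b + d) ≡ a + b + (c + d)
    interchange = solve-∀

  counting-arith : ∀ {m L N F} → L * suc m ≤ N + F → 6 * F + m ≡ m * m * m →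
                   3 * N < suc m * suc m * suc m → 2 * L ≤ m * suc m
  counting-arith {m} {L} {N} {F} L≤N+F sixF+m≡m³ 3N<[1+m]³ with 2 * L ≤? m * suc m
  ... | yes 2L≤ = 2L≤
  ... | no 2L≰ = contradiction (begin
    bound + suc (m + 2)                     ≡⟨ excess m ⟩
    3 * suc m * suc (m * suc m) + 2 + m     ≤⟨ +-monoˡ-≤ m (+-monoˡ-≤ 2 (*-monoʳ-≤ (3 * suc m) (≰⇒> 2L≰))) ⟩
    3 * suc m * (2 * L) + 2 + m             ≡⟨ cong (λ z → z + 2 + m) (six m L) ⟩
    6 * (L * suc m) + 2 + m                 ≤⟨ +-monoˡ-≤ m (+-monoˡ-≤ 2 (*-monoʳ-≤ 6 L≤N+F)) ⟩
    6 * (N + F) + 2 + m                     ≡⟨ regroup N F m ⟩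
    2 * suc (3 * N) + (6 * F + m)           ≤⟨ +-mono-≤ (*-monoʳ-≤ 2 3N<[1+m]³) (≤-reflexive sixF+m≡m³) ⟩
    bound                                   ∎) (m+1+n≰m bound)
    where
    open ≤-Reasoning
    bound = 2 * (suc m * suc m * suc m) + m * m * m
    excess : ∀ m → 2 * (suc m * suc m * suc m) + m * m * m + suc (m + 2) ≡ 3 * suc m * suc (m * suc m) + 2 + m
    excess = solve-∀
    six : ∀ m L → 3 * suc m * (2 * L) ≡ 6 * (L * suc m)
    six = solve-∀
    regroup : ∀ N F m → 6 * (N + F) + 2 + m ≡ 2 * suc (3 * N) + (6 * F + m)
    regroup = solve-∀

  charges-bound : ∀ {i m N S} → Unique S → All (Covers i) S → cost S ≤ N →
                  3 * N < suc m * suc m * suc m → 2 * length S ≤ m * suc m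
  charges-bound {i} {m} {N} {S} unique covering cost≤N 3N<[1+m]³ =
    counting-arith {m} {length S} {N} {shortfallSum m m}
      (≤-trans (length*≤cost+shortfall m S) (+-mono-≤ cost≤N shortfalls))
      (6*shortfallSum+m≡m³ m) 3N<[1+m]³
    where
    short : ∀ {a} → a ∈ S → shortfall m a ≡ 0 ⊎ a ∈ shortIntervals i m
    short {p , l} a∈S with l ≤? m
    ... | yes l≤m = inj₂ (Covers⇒∈-shortIntervals (All.lookup covering a∈S) l≤m)
    ... | no l≰m  = inj₁ (m≤n⇒m∸n≡0 (<⇒≤ (≰⇒> l≰m)))
    shortfalls : sum (map (shortfall m) S) ≤ shortfallSum m m
    shortfalls = subst (sum (map (shortfall m) S) ≤_) (sum-shortfall-shortIntervals m i m)
                       (sum-map-Unique-≤ (shortfall m) unique short)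

  avoids : ∀ {i c l} → ¬ Covers i (c , l) → ∀ {r} → r < l → c + r ≢ i
  avoids {c = c} ¬covers {r} r<l refl = ¬covers (m≤m+n c r , +-monoʳ-< c r<l)

  step-combine : ∀ {a t e u s s₁ s′ b b₁} → a ≤ e + suc t → t + s₁ ≤ u + s′ + b₁ →
                 e + s + b₁ ≤ s₁ + b → a + s ≤ suc u + s′ + b
  step-combine {a} {t} {e} {u} {s} {s₁} {s′} {b} {b₁} a≤ rec paid =
    +-cancelʳ-≤ b₁ (a + s) (suc u + s′ + b) (begin
      a + s + b₁               ≤⟨ +-monoˡ-≤ b₁ (+-monoˡ-≤ s a≤) ⟩
      e + suc t + s + b₁       ≡⟨ shuffle₁ e t s b₁ ⟩
      suc t + (e + s + b₁)     ≤⟨ +-monoʳ-≤ (suc t) paid ⟩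
      suc t + (s₁ + b)         ≡⟨ cong suc (sym (+-assoc t s₁ b)) ⟩
      suc (t + s₁) + b         ≤⟨ +-monoˡ-≤ b (s≤s rec) ⟩
      suc (u + s′ + b₁) + b    ≡⟨ shuffle₂ u s′ b₁ b ⟩
      suc u + s′ + b + b₁      ∎)
    where
    open ≤-Reasoning
    shuffle₁ : ∀ e t s b₁ → e + suc t + s + b₁ ≡ suc t + (e + s + b₁)
    shuffle₁ = solve-∀
    shuffle₂ : ∀ u s′ b₁ b → suc (u + s′ + b₁) + b ≡ suc u + s′ + b + b₁
    shuffle₂ = solve-∀

  module Neighbours {k n : ℕ} (w w′ : Vec (Fin k) n) (i : ℕ)
                    (same : ∀ {j} → j ≢ i → at w j ≡ at w′ j) where

    module G  = Greedy w
    module G′ = Greedy w′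
    open MatchProperties w using (Agree-sym; Agree-trans)

    Agree-transfer : ∀ {a b} → a ≢ i → b ≢ i → Agree w a b → Agree w′ a b
    Agree-transfer a≢i b≢i = subst₂ (λ u z → eqM u z ≡ true) (same a≢i) (same b≢i)

    beyond : ∀ {c} → i < c → ∀ r → c + r ≢ i
    beyond {c} i<c r c+r≡i = <-irrefl (sym c+r≡i) (<-≤-trans i<c (m≤m+n c r))

    offset-≢ : ∀ {c d r} → c + d ≡ i → r ≢ d → c + r ≢ i
    offset-≢ {c} c+d≡i r≢d c+r≡i = r≢d (+-cancelˡ-≡ c _ _ (trans c+r≡i (sym c+d≡i)))

    -- Every charged source interval (p , l) has been seen as a target beyond i, where w and w′ agree.
    Witnessed : List (ℕ × ℕ) → ℕ → Set
    Witnessed S x = ∀ {p l} → (p , l) ∈ S → ∃[ y ] i < y × y + l ≤ x × Match w p y l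

    -- b is the budget for the single phrase of w whose target contains i.
    record Invariant (x : ℕ) (S : List (ℕ × ℕ)) (b : ℕ) : Set where
      field
        budget     : x ≤ i → 1 ≤ b
        unique     : Unique S
        covering   : All (Covers i) S
        affordable : cost S ≤ x
        witnessed  : Witnessed S x

    Invariant-advance : ∀ {x y S b b′} → x ≤ y → (y ≤ i → 1 ≤ b′) → Invariant x S b → Invariant y S b′
    Invariant-advance x≤y budget′ inv = record
      { budget     = budget′
      ; unique     = unique
      ; covering   = covering
      ; affordable = ≤-trans affordable x≤y
      ; witnessed  = λ p∈S → let (z , i<z , z+l≤x , h) = witnessed p∈S in z , i<z , ≤-trans z+l≤x x≤y , h
      }
      where open Invariant inv

    record Step (x : ℕ) (S : List (ℕ × ℕ)) (b : ℕ) : Set where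
      field
        extra     : ℕ
        S₁        : List (ℕ × ℕ)
        b₁        : ℕ
        bound     : G′.blocks n x ≤ extra + suc (G′.blocks n (G.next x))
        paid      : extra + length S + b₁ ≤ length S₁ + b
        invariant : Invariant (G.next x) S₁ b₁

    module _ {x S b} (x<n : x < n) (inv : Invariant x S b) where

      open Invariant inv

      private
        l = G.len x
        p = G.src x
        p+l≤x : p + l ≤ x
        p+l≤x = proj₁ (G.src-matches x<n)
        match : Match w p x l
        match = proj₂ (G.src-matches x<n)
        fits : x + l < n
        fits = G.len-fits x<n
        x≤next : x ≤ G.next x
        x≤next = <⇒≤ (G.x<next x)
        advance : Invariant (G.next x) S b
        advance = Invariant-advance x≤next (budget ∘ ≤-trans x≤next) inv

      keep : Copyable w′ x l → Step x S b
      keep copyable = record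
        { extra = 0 ; S₁ = S ; b₁ = b
        ; bound     = G′.blocks-copyable n fits copyable
        ; paid      = ≤-refl
        ; invariant = advance
        }

      untouched : ¬ Covers i (x , l) → ¬ Covers i (p , l) → Step x S b
      untouched ¬target ¬source = keep
        (p , p+l≤x , λ r<l → Agree-transfer (avoids ¬target r<l) (avoids ¬source r<l) (match r<l))

      -- The earlier copy of the same factor lies beyond i, so it serves as a source in w′ too.
      recharged : i < x → (p , l) ∈ S → Step x S b
      recharged i<x p,l∈S with witnessed p,l∈S
      ... | y , i<y , y+l≤x , match′ = keep
        (y , y+l≤x , λ {r} r<l → Agree-transfer (beyond i<x r) (beyond i<y r)
                                   (Agree-trans (match r<l) (Agree-sym (match′ r<l))))

      target-split : Covers i (x , l) → Step x S b
      target-split (x≤i , i<x+l) = record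
        { extra = 1 ; S₁ = S ; b₁ = 0
        ; bound     = G′.blocks-one-mismatch fits p+l≤x d<l λ {r} r<l r≢d →
            Agree-transfer (offset-≢ x+d≡i r≢d)
                           (λ p+r≡i → <-irrefl p+r≡i (<-≤-trans (+-monoʳ-< p r<l) (≤-trans p+l≤x x≤i)))
                           (match r<l)
        ; paid      = subst (_≤ length S + b) (sym (trans (+-identityʳ _) (+-comm 1 (length S))))
                            (+-monoʳ-≤ (length S) (budget x≤i))
        ; invariant = Invariant-advance x≤next
            (λ next≤i → contradiction (<-≤-trans i<x+l (≤-trans (m≤m+n (x + l) 1) next≤i)) (<-irrefl refl)) inv
        }
        where
        d = i ∸ x
        x+d≡i : x + d ≡ i
        x+d≡i = m+[n∸m]≡n x≤i
        d<l : d < l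
        d<l = +-cancelˡ-< x d l (subst (_< x + l) (sym x+d≡i) i<x+l)

      source-split : Covers i (p , l) → (p , l) ∉ S → Step x S b
      source-split (p≤i , i<p+l) p,l∉S = record
        { extra = 1 ; S₁ = (p , l) ∷ S ; b₁ = b
        ; bound     = G′.blocks-one-mismatch fits p+l≤x d<l λ {r} r<l r≢d →
            Agree-transfer (beyond i<x r) (offset-≢ p+d≡i r≢d) (match r<l)
        ; paid      = ≤-refl
        ; invariant = record
            { budget     = budget ∘ ≤-trans x≤next
            ; unique     = ¬Any⇒All¬ S p,l∉S ∷ unique
            ; covering   = (p≤i , i<p+l) ∷ covering
            ; affordable = subst (suc l + cost S ≤_) (trans (+-comm (suc l) x) (sym (m+n+1≡m+[1+n] x l)))
                                 (+-monoʳ-≤ (suc l) affordable)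
            ; witnessed  = λ { (here refl) → x , i<x , m≤m+n (x + l) 1 , match
                             ; (there q∈S) → Invariant.witnessed advance q∈S }
            }
        }
        where
        i<x = <-≤-trans i<p+l p+l≤x
        d = i ∸ p
        p+d≡i : p + d ≡ i
        p+d≡i = m+[n∸m]≡n p≤i
        d<l : d < l
        d<l = +-cancelˡ-< p d l (subst (_< p + l) (sym p+d≡i) i<p+l)

      step : Step x S b
      step with (x ≤? i) ×-dec (i <? x + l)
      ... | yes target = target-split target
      ... | no ¬target with (p ≤? i) ×-dec (i <? p + l)
      ...   | no ¬source = untouched ¬target ¬source
      ...   | yes source with (p , l) ∈? S
      ...     | yes p,l∈S = recharged (<-≤-trans (proj₂ source) p+l≤x) p,l∈S
      ...     | no p,l∉S  = source-split source p,l∉S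

    Charged : List (ℕ × ℕ) → Set
    Charged S = Unique S × All (Covers i) S × cost S ≤ n

    charge : ∀ f x {S b} → x ≤ n → n ∸ x ≤ f → Invariant x S b →
             ∃[ S′ ] Charged S′ × G′.blocks n x + length S ≤ G.blocks f x + length S′ + b
    charge f x {S} {b} x≤n fuel inv with n ≤? x
    ... | yes n≤x = S , (unique , covering , ≤-trans affordable x≤n) ,
          subst (λ t → t + length S ≤ G.blocks f x + length S + b) (sym (G′.blocks-done n n≤x))
                (≤-trans (m≤n+m (length S) (G.blocks f x)) (m≤m+n _ b))
      where open Invariant inv
    charge zero    x x≤n fuel inv | no n≰x = contradiction fuel (<⇒≱ (m<n⇒0<n∸m (≰⇒> n≰x)))
    charge (suc f) x {S} {b} x≤n fuel inv | no n≰x =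
      let S′ , charged , rest = charge f (G.next x) (G.next≤n x<n) (G.fuel-next x fuel) invariant
      in S′ , charged , subst (λ t → G′.blocks n x + length S ≤ t + length S′ + b) (sym (G.blocks-step f x<n))
                              (step-combine {u = G.blocks f (G.next x)} {s′ = length S′} bound rest paid)
      where
      x<n = ≰⇒> n≰x
      open Step (step x<n inv)

    length-LZ77-neighbour : ∀ m → 3 * n < suc m * suc m * suc m →
      ∃[ E ] length (LZ77 n w′) ≤ length (LZ77 n w) + E × 2 * E ≤ m * suc m + 2
    length-LZ77-neighbour m 3n<[1+m]³ =
      let S′ , (unique , covering , affordable) , bound = charge n 0 z≤n ≤-refl initial
      in length S′ + 1 ,
         ≤-trans (≤-reflexive (sym (+-identityʳ _))) (≤-trans bound (≤-reflexive (+-assoc _ (length S′) 1))) ,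
         subst (_≤ m * suc m + 2) (sym (*-distribˡ-+ 2 (length S′) 1))
               (+-monoˡ-≤ 2 (charges-bound {m = m} unique covering affordable 3n<[1+m]³))
      where
      initial : Invariant 0 [] 1
      initial = record { budget = λ _ → ≤-refl ; unique = [] ; covering = []
                       ; affordable = z≤n ; witnessed = λ () }

  lookup-≡⇒at-≡ : ∀ {k n} {w w′ : Vec (Fin k) n} {i : Fin n} → (∀ j → ¬ j ≡ i → lookup w j ≡ lookup w′ j) →
                  ∀ {j} → j ≢ toℕ i → at w j ≡ at w′ j
  lookup-≡⇒at-≡ {n = n} {i = i} agree {j} j≢i with j <? n
  ... | yes j<n = cong just (agree (fromℕ< j<n) λ j≡i → j≢i (trans (sym (toℕ-fromℕ< j<n)) (cong toℕ j≡i)))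
  ... | no _    = refl

  integer-cube-root : ∀ X → ∃[ m ] m * m * m ≤ X × X < suc m * suc m * suc m
  integer-cube-root zero = 0 , z≤n , s≤s z≤n
  integer-cube-root (suc X) with integer-cube-root X
  ... | m , m³≤X , X<[1+m]³ with suc X <? suc m * suc m * suc m
  ...   | yes 1+X<[1+m]³ = m , m≤n⇒m≤1+n m³≤X , 1+X<[1+m]³
  ...   | no 1+X≮[1+m]³ = suc m , ≤-reflexive [1+m]³≡1+X ,
          subst (_< suc (suc m) * suc (suc m) * suc (suc m)) [1+m]³≡1+X
                (≤-trans (s≤s (m≤m+n _ _)) (≤-reflexive (sym (next-cube m))))
    where
    [1+m]³≡1+X : suc m * suc m * suc m ≡ suc X
    [1+m]³≡1+X = ≤-antisym (≮⇒≥ 1+X≮[1+m]³) X<[1+m]³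
    next-cube : ∀ m → suc (suc m) * suc (suc m) * suc (suc m)
                    ≡ suc (suc m * suc m * suc m + (3 * m * m + 9 * m + 6))
    next-cube = solve-∀

  cube-of-square-≤ : ∀ x n → x * x * x ≤ 3 * n → (x * x) * (x * x) * (x * x) ≤ 9 * (n * n)
  cube-of-square-≤ x n x³≤3n = subst₂ _≤_ (sixth x) (nine n) (*-mono-≤ x³≤3n x³≤3n)
    where
    sixth : ∀ x → (x * x * x) * (x * x * x) ≡ (x * x) * (x * x) * (x * x)
    sixth = solve-∀
    nine : ∀ n → (3 * n) * (3 * n) ≡ 9 * (n * n)
    nine = solve-∀

open Parsing
open import Data.Nat as ℕ using (ℕ; suc; z≤n)
import Data.Nat.Properties as ℕ
open import Data.Integer as ℤ using (+_)
import Data.Integer.Properties as ℤ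
open import Data.Rational
  using (ℚ; mkℚ; _/_; _+_; _-_; _*_; _≤_; _<_; ∣_∣; ½; 0ℚ; 1ℚ; -_; *≤*; nonNegative; positive)
open import Data.Rational.Properties
open import Algebra.Properties.AbelianGroup +-0-abelianGroup using (xyx⁻¹≈y; ⁻¹-anti-homo‿-)
import Data.Nat.Coprimality as Coprimality
open import Data.Fin using (Fin; toℕ)
open import Data.Vec using (Vec)
open import Data.Product using (_,_)
open import Data.Sum using (inj₁; inj₂)
open import Data.List using (length)
open import Relation.Nullary using (yes; no; contradiction)
open import Relation.Binary.PropositionalEquality

fromℕ : ℕ → ℚ
fromℕ x = + x / 1

fromℕ≡mkℚ : ∀ x → fromℕ x ≡ mkℚ (+ x) 0 (Coprimality.sym (Coprimality.1-coprimeTo x))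
fromℕ≡mkℚ x = normalize-coprime (Coprimality.sym (Coprimality.1-coprimeTo x))

fromℕ-+ : ∀ x y → fromℕ (x ℕ.+ y) ≡ fromℕ x + fromℕ y
fromℕ-+ x y rewrite fromℕ≡mkℚ x | fromℕ≡mkℚ y =
  cong (_/ 1) (trans (ℤ.pos-+ x y) (cong₂ ℤ._+_ (sym (ℤ.*-identityʳ (+ x))) (sym (ℤ.*-identityʳ (+ y)))))

fromℕ-* : ∀ x y → fromℕ (x ℕ.* y) ≡ fromℕ x * fromℕ y
fromℕ-* x y rewrite fromℕ≡mkℚ x | fromℕ≡mkℚ y = cong (_/ 1) (ℤ.pos-* x y)

fromℕ-mono-≤ : ∀ {x y} → x ℕ.≤ y → fromℕ x ≤ fromℕ y
fromℕ-mono-≤ {x} {y} x≤y rewrite fromℕ≡mkℚ x | fromℕ≡mkℚ y =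
  *≤* (subst₂ ℤ._≤_ (sym (ℤ.*-identityʳ (+ x))) (sym (ℤ.*-identityʳ (+ y))) (ℤ.+≤+ x≤y))

fromℕ-nonNeg : ∀ x → 0ℚ ≤ fromℕ x
fromℕ-nonNeg x = fromℕ-mono-≤ {0} {x} z≤n

fromℕ-cube : ∀ m → fromℕ (m ℕ.* m ℕ.* m) ≡ fromℕ m * fromℕ m * fromℕ m
fromℕ-cube m = trans (fromℕ-* (m ℕ.* m) m) (cong (_* fromℕ m) (fromℕ-* m m))

∣p-q∣≤r : ∀ {p q r} → p ≤ q + r → q ≤ p + r → ∣ p - q ∣ ≤ r
∣p-q∣≤r {p} {q} {r} p≤q+r q≤p+r with ∣p∣≡p∨∣p∣≡-p (p - q)
... | inj₁ ∣p-q∣≡p-q = begin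
  ∣ p - q ∣    ≡⟨ ∣p-q∣≡p-q ⟩
  p - q        ≤⟨ +-monoˡ-≤ (- q) p≤q+r ⟩
  q + r - q    ≡⟨ xyx⁻¹≈y q r ⟩
  r            ∎
  where open ≤-Reasoning
... | inj₂ ∣p-q∣≡q-p = begin
  ∣ p - q ∣    ≡⟨ ∣p-q∣≡q-p ⟩
  - (p - q)    ≡⟨ ⁻¹-anti-homo‿- p q ⟩
  q - p        ≤⟨ +-monoˡ-≤ (- p) q≤p+r ⟩
  p + r - p    ≡⟨ xyx⁻¹≈y p r ⟩
  r            ∎
  where open ≤-Reasoning

cube-cancel-≤ : ∀ {x y} → 0ℚ ≤ x → 0ℚ ≤ y → x * x * x ≤ y * y * y → x ≤ y
cube-cancel-≤ {x} {y} 0≤x 0≤y x³≤y³ with x ≤? y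
... | yes x≤y = x≤y
... | no x≰y = contradiction (≤-<-trans x³≤y³ y³<x³) (<-irrefl refl)
  where
  y<x = ≰⇒> x≰y
  0<x = ≤-<-trans 0≤y y<x
  y²≤x² : y * y ≤ x * x
  y²≤x² = ≤-trans (*-monoˡ-≤-nonNeg y {{nonNegative 0≤y}} (<⇒≤ y<x))
                  (*-monoʳ-≤-nonNeg x {{nonNegative 0≤x}} (<⇒≤ y<x))
  y³<x³ : y * y * y < x * x * x
  y³<x³ = ≤-<-trans (*-monoʳ-≤-nonNeg y {{nonNegative 0≤y}} y²≤x²)
                    (*-monoʳ-<-pos (x * x) {{pos*pos⇒pos x {{positive 0<x}} x {{positive 0<x}}}} y<x)

fromℕ-≤-cube-root : ∀ x {X y} → x ℕ.* x ℕ.* x ℕ.≤ X → fromℕ X ≤ y * y * y → 0ℚ ≤ y → fromℕ x ≤ y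
fromℕ-≤-cube-root x {X} {y} x³≤X X≤y³ 0≤y = cube-cancel-≤ (fromℕ-nonNeg x) 0≤y
  (≤-trans (≤-reflexive (sym (fromℕ-cube x))) (≤-trans (fromℕ-mono-≤ x³≤X) X≤y³))

½-bound : ∀ E X Y {a c} → 2 ℕ.* E ℕ.≤ X ℕ.+ Y ℕ.+ 2 → fromℕ X ≤ a → fromℕ Y ≤ c →
          fromℕ E ≤ ½ * a + ½ * c + 1ℚ
½-bound E X Y {a} {c} 2E≤X+Y+2 X≤a Y≤c = begin
  fromℕ E                              ≡⟨ sym (*-identityˡ (fromℕ E)) ⟩
  ½ * fromℕ 2 * fromℕ E                ≡⟨ trans (*-assoc ½ (fromℕ 2) (fromℕ E)) (cong (½ *_) (sym (fromℕ-* 2 E))) ⟩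
  ½ * fromℕ (2 ℕ.* E)                  ≤⟨ *-monoˡ-≤-nonNeg ½ (fromℕ-mono-≤ 2E≤X+Y+2) ⟩
  ½ * fromℕ (X ℕ.+ Y ℕ.+ 2)            ≡⟨ cong (½ *_) (trans (fromℕ-+ (X ℕ.+ Y) 2) (cong (_+ fromℕ 2) (fromℕ-+ X Y))) ⟩
  ½ * (fromℕ X + fromℕ Y + fromℕ 2)    ≡⟨ trans (*-distribˡ-+ ½ (fromℕ X + fromℕ Y) (fromℕ 2)) (cong (_+ ½ * fromℕ 2) (*-distribˡ-+ ½ (fromℕ X) (fromℕ Y))) ⟩
  ½ * fromℕ X + ½ * fromℕ Y + 1ℚ       ≤⟨ +-monoˡ-≤ 1ℚ (+-mono-≤ (*-monoˡ-≤-nonNeg ½ X≤a) (*-monoˡ-≤-nonNeg ½ Y≤c)) ⟩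
  ½ * a + ½ * c + 1ℚ                   ∎
  where open ≤-Reasoning

fromℕ-*-≤-+ : ∀ {t} t′ E B {r} → t ℕ.≤ t′ ℕ.+ E → fromℕ E ≤ r → fromℕ (t ℕ.* B) ≤ fromℕ (t′ ℕ.* B) + r * fromℕ B
fromℕ-*-≤-+ {t} t′ E B {r} t≤t′+E E≤r = begin
  fromℕ (t ℕ.* B)                     ≤⟨ fromℕ-mono-≤ (ℕ.*-monoˡ-≤ B t≤t′+E) ⟩
  fromℕ ((t′ ℕ.+ E) ℕ.* B)            ≡⟨ trans (cong fromℕ (ℕ.*-distribʳ-+ B t′ E)) (fromℕ-+ (t′ ℕ.* B) (E ℕ.* B)) ⟩
  fromℕ (t′ ℕ.* B) + fromℕ (E ℕ.* B)  ≡⟨ cong (λ z → fromℕ (t′ ℕ.* B) + z) (fromℕ-* E B) ⟩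
  fromℕ (t′ ℕ.* B) + fromℕ E * fromℕ B ≤⟨ +-monoʳ-≤ (fromℕ (t′ ℕ.* B)) (*-monoʳ-≤-nonNeg (fromℕ B) {{nonNegative (fromℕ-nonNeg B)}} E≤r) ⟩
  fromℕ (t′ ℕ.* B) + r * fromℕ B      ∎
  where open ≤-Reasoning

excess-≤ : ∀ n m E {a c} → 0ℚ ≤ a → 0ℚ ≤ c →
  fromℕ 9 * (fromℕ n * fromℕ n) ≤ a * a * a → fromℕ 3 * fromℕ n ≤ c * c * c →
  m ℕ.* m ℕ.* m ℕ.≤ 3 ℕ.* n → 2 ℕ.* E ℕ.≤ m ℕ.* suc m ℕ.+ 2 → fromℕ E ≤ ½ * a + ½ * c + 1ℚ
excess-≤ n m E {a} {c} 0≤a 0≤c 9n²≤a³ 3n≤c³ m³≤3n 2E≤ = ½-bound E (m ℕ.* m) m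
  (subst (2 ℕ.* E ℕ.≤_) (cong (ℕ._+ 2) (trans (ℕ.*-suc m m) (ℕ.+-comm m (m ℕ.* m)))) 2E≤) m²≤a m≤c
  where
  m≤c : fromℕ m ≤ c
  m≤c = fromℕ-≤-cube-root m m³≤3n (subst (_≤ c * c * c) (sym (fromℕ-* 3 n)) 3n≤c³) 0≤c
  m²≤a : fromℕ (m ℕ.* m) ≤ a
  m²≤a = fromℕ-≤-cube-root (m ℕ.* m) (cube-of-square-≤ m n m³≤3n)
           (subst (_≤ a * a * a) (sym (trans (fromℕ-* 9 (n ℕ.* n)) (cong (fromℕ 9 *_) (fromℕ-* n n)))) 9n²≤a³)
           0≤a

theorem3 : (k n : ℕ) (w w' : Vec (Fin k) n) → Neighbors w w' →
    (a c : ℚ) → 0ℚ ≤ a → 0ℚ ≤ c →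
    (+ 9 / 1) * ((+ n / 1) * (+ n / 1)) ≤ a * a * a →
    (+ 3 / 1) * (+ n / 1) ≤ c * c * c →
    ∣ (+ compressSize w / 1) - (+ compressSize w' / 1) ∣
      ≤ (½ * a + ½ * c + 1ℚ) * (+ blockBits k n / 1)
theorem3 k n w w' (i , _ , agree) a c 0≤a 0≤c 9n²≤a³ 3n≤c³ =
  let m , m³≤3n , 3n<[1+m]³ = integer-cube-root (3 ℕ.* n)
      E₁ , t′≤t+E₁ , 2E₁≤ = Neighbours.length-LZ77-neighbour w w' (toℕ i) (lookup-≡⇒at-≡ agree) m 3n<[1+m]³
      E₂ , t≤t′+E₂ , 2E₂≤ = Neighbours.length-LZ77-neighbour w' w (toℕ i) (λ j≢i → sym (lookup-≡⇒at-≡ agree j≢i)) m 3n<[1+m]³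
      excess-≤′ = λ E → excess-≤ n m E 0≤a 0≤c 9n²≤a³ 3n≤c³ m³≤3n
  in ∣p-q∣≤r (fromℕ-*-≤-+ (length (LZ77 n w')) E₂ (blockBits k n) t≤t′+E₂ (excess-≤′ E₂ 2E₂≤))
             (fromℕ-*-≤-+ (length (LZ77 n w)) E₁ (blockBits k n) t′≤t+E₁ (excess-≤′ E₁ 2E₁≤))
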